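{- Let $2\le n\le 5$, $M_n=\{1,2,\dots,n\}$, and let $\mathcal{F}\subseteq 2^{M_n}$ be a union-closed family with $\emptyset\in\mathcal{F}$ and $\bigcup_{A\in\mathcal{F}}A=M_n$. Let $T(\mathcal{F})=\min\{1\le k\le n:\ \mathcal{F}\text{ contains a set of cardinality }k\}$. If $T(\mathcal{F})=k\ge 2$, then there exist at least $k$ distinct elements $i\in M_n$ such that $|\{A\in\mathcal{F}: i\in A\}|\ge \tfrac12|\mathcal{F}|$. In particular, if $T(\mathcal{F})\ge 2$, then at least two elements of $M_n$ each belong to at least half of the sets in $\mathcal{F}$.
   Context: A family $\mathcal{F}$ is union-closed if $A\cup B\in\mathcal{F}$ for all $A,B\in\mathcal{F}$. -}

module Defs where

open import Data.Nat using (ℕ; _≤_; _*_; _+_)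
open import Data.Fin using (Fin)
open import Data.Fin.Subset using (Subset; _∪_; ⊥; ∣_∣; _∈_; Nonempty)
open import Data.Fin.Subset.Properties using (_∈?_)
open import Data.List using (List; length; filter)
open import Data.List.Relation.Unary.Unique.Propositional using (Unique)
open import Data.Product using (Σ; _×_; ∃-syntax)
import Data.List.Membership.Propositional as LM

-- A family of subsets of M_n = Fin n, represented as a duplicate-free list.
Family : ℕ → Set
Family n = List (Subset n)

module _ {n : ℕ} where
  open LM renaming (_∈_ to _∈F_)

  IsFamily : Family n → Set
  IsFamily F = Unique F

  UnionClosed : Family n → Set
  UnionClosed F = ∀ {A B} → A ∈F F → B ∈F F → (A ∪ B) ∈F F

  ContainsEmpty : Family n → Set
  ContainsEmpty F = ⊥ ∈F F

  CoversGround : Family n → Set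
  CoversGround F = ∀ (i : Fin n) → ∃[ A ] (A ∈F F × i ∈ A)

  -- T(F) = k : k is the minimum cardinality of a nonempty member of F
  -- (note 1 ≤ |A| ≤ n for nonempty A ⊆ M_n)
  TEquals : Family n → ℕ → Set
  TEquals F k = (∃[ A ] (A ∈F F × ∣ A ∣ ≡ k × 1 ≤ k))
              × (∀ {A} → A ∈F F → Nonempty A → k ≤ ∣ A ∣)
    where open import Relation.Binary.PropositionalEquality using (_≡_)

  degree : Family n → Fin n → ℕ
  degree F i = length (filter (i ∈?_) F)

  Abundant : Family n → Fin n → Set
  Abundant F i = length F ≤ 2 * degree F i

-- Let A be the set of abundant elements and suppose |A| < k = T(F). Then F contains ∅ and a
-- nonempty set, every element outside A lies in fewer than half of the members, and every
-- nonempty member has at least k > max(1, |A|) elements. Moreover no member is a pair {a, b}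
-- of non-abundant elements: if {a, b} ∈ F, then x ↦ x ∪ {a, b} injects the members avoiding
-- a and b into those containing both, so |F| ≤ deg a + deg b. For n ≤ 5 a branch-and-bound
-- search through the families of subsets of M_n, run for every candidate A, shows that no
-- family has all these properties.

module Submission where

open import Defs
open import Data.Nat using (ℕ; _≤_)
open import Data.Fin using (Fin)
open import Data.List using (List; length)
open import Data.List.Relation.Unary.All using (All)
open import Data.List.Relation.Unary.Unique.Propositional using (Unique)
open import Data.Product using (_×_; ∃-syntax)

open import Data.Bool using (Bool; true; false; not; _∧_; _∨_; if_then_else_)
import Data.Bool as Bool
open import Data.Bool.ListAction using (all)
open import Data.Bool.Properties using (∧-zeroʳ; T-≡; not-¬)
open import Data.Fin using (zero; suc)
import Data.Fin.Properties as Fin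
open import Data.Fin.Subset
  using (Subset; inside; outside; _∪_; ∣_∣; _∈_; _∉_; Nonempty; ⁅_⁆; ⋃)
open import Data.Fin.Subset.Properties
  using (_∈?_; _⊆?_; nonempty?; x∈p∪q⁺; x∈p∪q⁻; p⊆p∪q; q⊆p∪q; ⊆-antisym;
         x∈⁅x⁆; x∈⁅y⁆⇒x≡y; Empty-unique; ∣⊥∣≡0)
open import Data.List using ([]; _∷_; _++_; [_]; map; filter; allFin)
import Data.List as List
open import Data.List.Membership.Propositional using (lose) renaming (_∈_ to _∈ₗ_)
open import Data.List.Membership.Propositional.Properties
  using (∈-∃++; ∈-++⁻; ∈-++⁺ˡ; ∈-++⁺ʳ; ∈-map⁺; ∈-map⁻; ∈-filter⁺; ∈-filter⁻)
open import Data.List.Properties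
  using (length-++; length-++-sucʳ; length-map; filter-++; ++-assoc; ++-identityʳ)
open import Data.List.Relation.Binary.Subset.Propositional using () renaming (_⊆_ to _⊆ₗ_)
import Data.List.Relation.Binary.Subset.Propositional.Properties as ⊆ₗ
import Data.List.Relation.Binary.Sublist.Propositional.Properties as Sublist
open import Data.List.Relation.Unary.All using ([]; _∷_)
import Data.List.Relation.Unary.All as All
import Data.List.Relation.Unary.All.Properties as All
open import Data.List.Relation.Unary.AllPairs using ([]; _∷_)
open import Data.List.Relation.Unary.Any using (Any; here; there; any?)
import Data.List.Relation.Unary.Unique.Propositional.Properties as Unique
open import Data.Nat using (zero; suc; _+_; _*_; _<_; _⊔_; z≤n; s≤s; _<?_; _≤?_)
open import Data.Nat.Properties
  using (≤-antisym; ≤-trans; <-irrefl; ≮⇒≥; ≰⇒>; m≤m+n; +-monoʳ-≤; +-suc; +-comm;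
         +-identityʳ; +-cancelˡ-<; +-cancelˡ-≤; +-cancelʳ-≤; ⊔-lub; module ≤-Reasoning)
open import Data.Product using (_,_; ∃₂; proj₁; proj₂)
open import Data.Sum using (inj₁; inj₂)
open import Data.Vec using (Vec; []; _∷_)
import Data.Vec as Vec
open import Data.Vec.Properties using (≡-dec; ∷-injectiveʳ; lookup∘tabulate; lookup⇒[]=)
open import Function using (_∘_; id; Equivalence)
open import Relation.Binary using (DecidableEquality)
open import Relation.Binary.PropositionalEquality
  using (_≡_; _≢_; refl; sym; trans; cong; subst; subst₂)
open import Relation.Nullary using (¬_; Dec; yes; no; does; contradiction)
open import Relation.Nullary.Decidable using (¬?; _×-dec_; _→-dec_; dec-true; dec-false)
open import Relation.Unary using (Pred; Decidable)
open import Relation.Unary.Properties using (∁?; _∩?_)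

module _ {a} {X : Set a} where

  Unique⇒length≤ : ∀ {xs ys : List X} → Unique xs → xs ⊆ₗ ys → length xs ≤ length ys
  Unique⇒length≤ {[]} _ _ = z≤n
  Unique⇒length≤ {x ∷ xs} (x∉xs ∷ xs!) x∷xs⊆ys
    with us , vs , refl ← ∈-∃++ (x∷xs⊆ys (here refl)) = begin
      suc (length xs)         ≤⟨ s≤s (Unique⇒length≤ xs! xs⊆us++vs) ⟩
      suc (length (us ++ vs)) ≡⟨ length-++-sucʳ us x vs ⟨
      length (us ++ x ∷ vs)   ∎
    where
    open ≤-Reasoning
    xs⊆us++vs : xs ⊆ₗ us ++ vs
    xs⊆us++vs y∈xs with ∈-++⁻ us (x∷xs⊆ys (there y∈xs))
    ... | inj₁ y∈us         = ∈-++⁺ˡ y∈us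
    ... | inj₂ (here refl)  = contradiction refl (All.lookup x∉xs y∈xs)
    ... | inj₂ (there y∈vs) = ∈-++⁺ʳ us y∈vs

  Unique⇒length≡ : ∀ {xs ys : List X} → Unique xs → Unique ys →
                   xs ⊆ₗ ys → ys ⊆ₗ xs → length xs ≡ length ys
  Unique⇒length≡ xs! ys! xs⊆ys ys⊆xs =
    ≤-antisym (Unique⇒length≤ xs! xs⊆ys) (Unique⇒length≤ ys! ys⊆xs)

  Unique-map⁺-injectiveOn : ∀ {b} {Y : Set b} (f : X → Y) {xs : List X} → Unique xs →
    (∀ {x y} → x ∈ₗ xs → y ∈ₗ xs → f x ≡ f y → x ≡ y) → Unique (map f xs)
  Unique-map⁺-injectiveOn f [] _ = []
  Unique-map⁺-injectiveOn f {x ∷ xs} (x∉xs ∷ xs!) inj =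
    All.tabulate fx∉ ∷ Unique-map⁺-injectiveOn f xs! (λ p q → inj (there p) (there q))
    where
    fx∉ : ∀ {z} → z ∈ₗ map f xs → f x ≢ z
    fx∉ z∈ fx≡z with y , y∈xs , refl ← ∈-map⁻ f z∈ =
      All.lookup x∉xs y∈xs (inj (here refl) (there y∈xs) fx≡z)

count : ∀ {a p} {X : Set a} {P : Pred X p} → Decidable P → List X → ℕ
count P? xs = length (filter P? xs)

module _ {a p} {X : Set a} {P : Pred X p} (P? : Decidable P) where

  Unique⇒count≡ : ∀ {xs ys : List X} → Unique xs → Unique ys →
                  xs ⊆ₗ ys → ys ⊆ₗ xs → count P? xs ≡ count P? ys
  Unique⇒count≡ xs! ys! xs⊆ys ys⊆xs = Unique⇒length≡
    (Unique.filter⁺ P? xs!) (Unique.filter⁺ P? ys!)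
    (⊆ₗ.filter⁺′ P? P? id xs⊆ys) (⊆ₗ.filter⁺′ P? P? id ys⊆xs)

  count-++ : ∀ xs ys → count P? (xs ++ ys) ≡ count P? xs + count P? ys
  count-++ xs ys = trans (cong length (filter-++ P? xs ys)) (length-++ (filter P? xs))

  count-filter≤ : ∀ {q} {Q : Pred X q} (Q? : Decidable Q) xs → count P? (filter Q? xs) ≤ count P? xs
  count-filter≤ Q? xs = Sublist.length-mono-≤
    (Sublist.filter⁺ P? P? (λ { refl → id }) (Sublist.filter-⊆ Q? xs))

  length≡count+count∁ : ∀ xs → length xs ≡ count P? xs + count (∁? P?) xs
  length≡count+count∁ []       = refl
  length≡count+count∁ (x ∷ xs) with P? x
  ... | yes _ = cong suc (length≡count+count∁ xs)
  ... | no _  = trans (cong suc (length≡count+count∁ xs)) (sym (+-suc (count P? xs) _))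

module _ {a p q} {X : Set a} {P : Pred X p} {Q : Pred X q}
         (P? : Decidable P) (Q? : Decidable Q) where

  length+count-both≡count+count+count-neither : ∀ xs →
    length xs + count (P? ∩? Q?) xs ≡ count P? xs + count Q? xs + count (∁? P? ∩? ∁? Q?) xs
  length+count-both≡count+count+count-neither [] = refl
  length+count-both≡count+count+count-neither (x ∷ xs)
    with P? x | Q? x | length+count-both≡count+count+count-neither xs
  ... | yes _ | yes _ | ih
    rewrite +-suc (length xs) (count (P? ∩? Q?) xs) | +-suc (count P? xs) (count Q? xs)
    = cong (λ m → suc (suc m)) ih
  ... | yes _ | no _  | ih = cong suc ih
  ... | no _  | yes _ | ih rewrite +-suc (count P? xs) (count Q? xs) = cong suc ih
  ... | no _  | no _  | ih
    rewrite +-suc (count P? xs + count Q? xs) (count (∁? P? ∩? ∁? Q?) xs) = cong suc ih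

subsets : ∀ n → List (Subset n)
subsets zero    = [ [] ]
subsets (suc n) = map (outside ∷_) (subsets n) ++ map (inside ∷_) (subsets n)

∈-subsets : ∀ {n} (p : Subset n) → p ∈ₗ subsets n
∈-subsets []                    = here refl
∈-subsets {suc n} (outside ∷ p) = ∈-++⁺ˡ (∈-map⁺ (outside ∷_) (∈-subsets p))
∈-subsets {suc n} (inside ∷ p)  =
  ∈-++⁺ʳ (map (outside ∷_) (subsets n)) (∈-map⁺ (inside ∷_) (∈-subsets p))

subsets-unique : ∀ n → Unique (subsets n)
subsets-unique zero    = [] ∷ []
subsets-unique (suc n) = Unique.++⁺ (Unique.map⁺ ∷-injectiveʳ (subsets-unique n))
                                    (Unique.map⁺ ∷-injectiveʳ (subsets-unique n)) disjoint
  where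
  disjoint : ∀ {p} → ¬ (p ∈ₗ map (outside ∷_) (subsets n) × p ∈ₗ map (inside ∷_) (subsets n))
  disjoint (p∈ , q∈)
    with _ , _ , refl ← ∈-map⁻ (outside ∷_) p∈ | _ , _ , () ← ∈-map⁻ (inside ∷_) q∈

∣tabulate∣≡count : ∀ {a p} {X : Set a} {P : Pred X p} (P? : Decidable P) {n} (g : Fin n → X) →
                   ∣ Vec.tabulate (does ∘ P? ∘ g) ∣ ≡ count P? (List.tabulate g)
∣tabulate∣≡count P? {zero}  g = refl
∣tabulate∣≡count P? {suc n} g with P? (g zero)
... | yes _ = cong suc (∣tabulate∣≡count P? (g ∘ suc))
... | no _  = ∣tabulate∣≡count P? (g ∘ suc)

∈-tabulate-does : ∀ {n p} {P : Pred (Fin n) p} (P? : Decidable P) {i} →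
                  P i → i ∈ Vec.tabulate (does ∘ P?)
∈-tabulate-does P? {i} Pi =
  lookup⇒[]= i _ (trans (lookup∘tabulate (does ∘ P?) i) (dec-true (P? i) Pi))

∣p∣>0⇒nonempty : ∀ {n} {p : Subset n} → 0 < ∣ p ∣ → Nonempty p
∣p∣>0⇒nonempty {n} {p} 0<∣p∣ with nonempty? p
... | yes p≢∅ = p≢∅
... | no  p≡∅ =
  contradiction (subst (0 <_) (trans (cong ∣_∣ (Empty-unique p≡∅)) (∣⊥∣≡0 n)) 0<∣p∣) λ ()

∪-cancelʳ-disjoint : ∀ {n} {x y s : Subset n} → (∀ {i} → i ∈ s → i ∉ x) →
                     (∀ {i} → i ∈ s → i ∉ y) → x ∪ s ≡ y ∪ s → x ≡ y
∪-cancelʳ-disjoint {s = s} x#s y#s x∪s≡y∪s =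
  ⊆-antisym (cancel x#s x∪s≡y∪s) (cancel y#s (sym x∪s≡y∪s))
  where
  cancel : ∀ {u v} → (∀ {i} → i ∈ s → i ∉ u) → u ∪ s ≡ v ∪ s → ∀ {i} → i ∈ u → i ∈ v
  cancel {v = v} u#s u∪s≡v∪s {i} i∈u
    with x∈p∪q⁻ v s (subst (i ∈_) u∪s≡v∪s (x∈p∪q⁺ (inj₁ i∈u)))
  ... | inj₁ i∈v = i∈v
  ... | inj₂ i∈s = contradiction i∈u (u#s i∈s)

infix 4 _≟ₛ_
_≟ₛ_ : ∀ {n} → DecidableEquality (Subset n)
_≟ₛ_ = ≡-dec Bool._≟_

module _ {n} {F : Family n} (closed : UnionClosed F) (∅∈F : ContainsEmpty F) where

  ⋃-closed : ∀ {xs} → All (_∈ₗ F) xs → ⋃ xs ∈ₗ F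
  ⋃-closed []           = ∅∈F
  ⋃-closed (x∈F ∷ xs∈F) = closed x∈F (⋃-closed xs∈F)

module _ {n : ℕ} where

  codegree : Family n → Fin n → ℕ
  codegree F i = count (∁? (i ∈?_)) F

  Rare : Family n → Fin n → Set
  Rare F i = degree F i < codegree F i

  length≡degree+codegree : ∀ F i → length F ≡ degree F i + codegree F i
  length≡degree+codegree F i = length≡count+count∁ (i ∈?_) F

  abundant? : (F : Family n) → Decidable (Abundant F)
  abundant? F i = length F ≤? 2 * degree F i

  ¬abundant⇒rare : ∀ {F i} → ¬ Abundant F i → Rare F i
  ¬abundant⇒rare {F} {i} ¬ab = +-cancelˡ-< (degree F i) (degree F i) (codegree F i) (begin-strict
    degree F i + degree F i   ≡⟨ cong (degree F i +_) (+-identityʳ (degree F i)) ⟨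
    2 * degree F i            <⟨ ≰⇒> ¬ab ⟩
    length F                  ≡⟨ length≡degree+codegree F i ⟩
    degree F i + codegree F i ∎)
    where open ≤-Reasoning

module _ {n} {F : Family n} (unique : Unique F) (closed : UnionClosed F) where

  length≤degree+degree : ∀ {a b} → ⁅ a ⁆ ∪ ⁅ b ⁆ ∈ₗ F → length F ≤ degree F a + degree F b
  length≤degree+degree {a} {b} S∈F =
    +-cancelʳ-≤ (length both) (length F) (degree F a + degree F b) (begin
      length F + length both
        ≡⟨ length+count-both≡count+count+count-neither (a ∈?_) (b ∈?_) F ⟩
      degree F a + degree F b + length neither
        ≤⟨ +-monoʳ-≤ (degree F a + degree F b) neither≤both ⟩
      degree F a + degree F b + length both ∎)
    where
    open ≤-Reasoning
    S : Subset n
    S = ⁅ a ⁆ ∪ ⁅ b ⁆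
    both? : Decidable (λ x → a ∈ x × b ∈ x)
    both? = (a ∈?_) ∩? (b ∈?_)
    neither? : Decidable (λ x → a ∉ x × b ∉ x)
    neither? = ∁? (a ∈?_) ∩? ∁? (b ∈?_)
    both neither : Family n
    both    = filter both? F
    neither = filter neither? F

    disjoint : ∀ {x} → x ∈ₗ neither → ∀ {i} → i ∈ S → i ∉ x
    disjoint {x} x∈ i∈S i∈x
      with ∈-filter⁻ neither? {xs = F} x∈ | x∈p∪q⁻ ⁅ a ⁆ ⁅ b ⁆ i∈S
    ... | _ , a∉x , _ | inj₁ i∈⁅a⁆ = a∉x (subst (_∈ x) (x∈⁅y⁆⇒x≡y a i∈⁅a⁆) i∈x)
    ... | _ , _ , b∉x | inj₂ i∈⁅b⁆ = b∉x (subst (_∈ x) (x∈⁅y⁆⇒x≡y b i∈⁅b⁆) i∈x)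

    ∪S∈both : ∀ {y} → y ∈ₗ map (_∪ S) neither → y ∈ₗ both
    ∪S∈both y∈ with x , x∈ , refl ← ∈-map⁻ (_∪ S) y∈ = ∈-filter⁺ both?
      (closed (proj₁ (∈-filter⁻ neither? {xs = F} x∈)) S∈F)
      ( q⊆p∪q x S (p⊆p∪q ⁅ b ⁆ (x∈⁅x⁆ a))
      , q⊆p∪q x S (q⊆p∪q ⁅ a ⁆ ⁅ b ⁆ (x∈⁅x⁆ b)))

    neither≤both : length neither ≤ length both
    neither≤both = subst (_≤ length both) (length-map (_∪ S) neither)
      (Unique⇒length≤ (Unique-map⁺-injectiveOn (_∪ S) (Unique.filter⁺ _ unique)
                         λ x∈ y∈ → ∪-cancelʳ-disjoint (disjoint x∈) (disjoint y∈))
                      ∪S∈both)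

  ¬rarePair : ∀ {a b} → ⁅ a ⁆ ∪ ⁅ b ⁆ ∈ₗ F → ¬ (Rare F a × Rare F b)
  ¬rarePair {a} {b} S∈F (rare-a , rare-b) = <-irrefl refl (begin-strict
    degree F a   <⟨ rare-a ⟩
    codegree F a ≤⟨ codegree≤degree pair ⟩
    degree F b   <⟨ rare-b ⟩
    codegree F b ≤⟨ codegree≤degree (subst (length F ≤_) (+-comm (degree F a) (degree F b)) pair) ⟩
    degree F a   ∎)
    where
    open ≤-Reasoning
    pair : length F ≤ degree F a + degree F b
    pair = length≤degree+degree S∈F
    codegree≤degree : ∀ {x y} → length F ≤ degree F x + degree F y → codegree F x ≤ degree F y
    codegree≤degree {x} {y} le = +-cancelˡ-≤ (degree F x) (codegree F x) (degree F y)
      (subst (_≤ degree F x + degree F y) (length≡degree+codegree F x) le)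

module Search {n : ℕ} (A : Subset n) where

  open import Data.List.Membership.DecPropositional (_≟ₛ_ {n}) using ()
    renaming (_∈?_ to _∈ₗ?_)

  RareOutside : Family n → Set
  RareOutside G = ∀ j → j ∉ A → Rare G j

  rareOutside? : Decidable RareOutside
  rareOutside? G = Fin.all? λ j → ¬? (j ∈? A) →-dec degree G j <? codegree G j

  RarePair : Subset n → Set
  RarePair s = ∃₂ λ i j → i ∉ A × j ∉ A × s ≡ ⁅ i ⁆ ∪ ⁅ j ⁆

  -- What T(F) > |A|, T(F) ≥ 2 and ¬rarePair leave possible for a member of F.
  Admissible : Subset n → Set
  Admissible s = Nonempty s → 1 ⊔ ∣ A ∣ < ∣ s ∣ × ¬ RarePair s

  admissible? : Decidable Admissible
  admissible? s = nonempty? s →-dec 1 ⊔ ∣ A ∣ <? ∣ s ∣ ×-dec ¬? (Fin.any? λ i →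
    Fin.any? λ j → ¬? (i ∈? A) ×-dec ¬? (j ∈? A) ×-dec s ≟ₛ ⁅ i ⁆ ∪ ⁅ j ⁆)

  record Counterexample (F : Family n) : Set where
    field
      unique     : Unique F
      closed     : UnionClosed F
      ∅∈F        : ContainsEmpty F
      admissible : All Admissible F
      rare       : RareOutside F
      nonempty   : Any Nonempty F

  Feasible : Family n → Vec ℕ n → Set
  Feasible ch spare = ∀ j → j ∉ A → degree ch j < codegree ch j + Vec.lookup spare j

  feasible? : ∀ ch spare → Dec (Feasible ch spare)
  feasible? ch spare = Fin.all? λ j →
    ¬? (j ∈? A) →-dec degree ch j <? codegree ch j + Vec.lookup spare j

  ⋃below : Family n → Subset n → Subset n
  ⋃below ch s = ⋃ (filter (_⊆? s) ch)

  withSpare : List (Subset n) → List (Subset n × Vec ℕ n)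
  withSpare []      = []
  withSpare (s ∷ r) = (s , Vec.tabulate (codegree (s ∷ r))) ∷ withSpare r

  -- If refuted (withSpare r) ch is true, no counterexample consists of the chosen sets ch
  -- and some of the pending sets r. A pending set that is a union of chosen sets cannot be
  -- left out, and a branch is cut as soon as some element outside A could not become rare
  -- even if all the pending sets avoiding it (counted by spare) were chosen.
  refuted : List (Subset n × Vec ℕ n) → Family n → Bool
  refuted [] ch = not (does (rareOutside? ch ×-dec any? nonempty? ch))
  refuted ((s , spare) ∷ r) ch =
    if does (feasible? ch spare)
    then (does (⋃below ch s ≟ₛ s) ∨ refuted r ch) ∧ refuted r (ch ++ [ s ])
    else true

  refutedAll : Bool
  refutedAll = refuted (withSpare (filter admissible? (subsets n))) []

  module _ {F : Family n} (cx : Counterexample F) where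
    open Counterexample cx

    _∈F? : Decidable (_∈ₗ F)
    s ∈F? = s ∈ₗ? F

    feasible : ∀ ch r → RareOutside (ch ++ filter _∈F? r) → Feasible ch (Vec.tabulate (codegree r))
    feasible ch r rare j j∉A = begin-strict
      degree ch j                   ≤⟨ m≤m+n (degree ch j) (degree Fr j) ⟩
      degree ch j + degree Fr j     ≡⟨ count-++ (j ∈?_) ch Fr ⟨
      degree (ch ++ Fr) j           <⟨ rare j j∉A ⟩
      codegree (ch ++ Fr) j         ≡⟨ count-++ (∁? (j ∈?_)) ch Fr ⟩
      codegree ch j + codegree Fr j
        ≤⟨ +-monoʳ-≤ (codegree ch j) (count-filter≤ (∁? (j ∈?_)) _∈F? r) ⟩
      codegree ch j + codegree r j  ≡⟨ cong (codegree ch j +_) (lookup∘tabulate (codegree r) j) ⟨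
      codegree ch j + Vec.lookup (Vec.tabulate (codegree r)) j ∎
      where
      open ≤-Reasoning
      Fr : Family n
      Fr = filter _∈F? r

    refuted-sound : ∀ r ch → All (_∈ₗ F) ch →
      RareOutside (ch ++ filter _∈F? r) → Any Nonempty (ch ++ filter _∈F? r) →
      refuted (withSpare r) ch ≡ false
    refuted-sound [] ch _ rare ne = cong not (dec-true (rareOutside? ch ×-dec any? nonempty? ch)
      (subst RareOutside (++-identityʳ ch) rare , subst (Any Nonempty) (++-identityʳ ch) ne))
    refuted-sound (s ∷ r) ch ch⊆F rare ne
      rewrite dec-true (feasible? ch (Vec.tabulate (codegree (s ∷ r)))) (feasible ch (s ∷ r) rare)
      with s ∈F?
    ... | yes s∈F = trans
      (cong (excluded ∧_) (refuted-sound r (ch ++ [ s ]) (All.++⁺ ch⊆F (s∈F ∷ []))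
                                          (subst RareOutside reassoc rare)
                                          (subst (Any Nonempty) reassoc ne)))
      (∧-zeroʳ excluded)
      where
      excluded : Bool
      excluded = does (⋃below ch s ≟ₛ s) ∨ refuted (withSpare r) ch
      reassoc : ch ++ s ∷ filter _∈F? r ≡ (ch ++ [ s ]) ++ filter _∈F? r
      reassoc = sym (++-assoc ch [ s ] (filter _∈F? r))
    ... | no s∉F
      rewrite dec-false (⋃below ch s ≟ₛ s) λ ⋃below≡s → s∉F (subst (_∈ₗ F) ⋃below≡s
                (⋃-closed closed ∅∈F (All.filter⁺ (_⊆? s) ch⊆F)))
      = cong (_∧ refuted (withSpare r) (ch ++ [ s ])) (refuted-sound r ch ch⊆F rare ne)

    refutedAll-sound : refutedAll ≡ false
    refutedAll-sound = refuted-sound pending [] []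
      (λ j j∉A → subst₂ _<_ (same (j ∈?_)) (same (∁? (j ∈?_))) (rare j j∉A))
      (⊆ₗ.Any-resp-⊆ F⊆realised nonempty)
      where
      pending realised : Family n
      pending  = filter admissible? (subsets n)
      realised = filter _∈F? pending
      F⊆realised : F ⊆ₗ realised
      F⊆realised {s} s∈F = ∈-filter⁺ _∈F?
        (∈-filter⁺ admissible? (∈-subsets s) (All.lookup admissible s∈F)) s∈F
      realised⊆F : realised ⊆ₗ F
      realised⊆F s∈ = proj₂ (∈-filter⁻ _∈F? {xs = pending} s∈)
      same : ∀ {p} {P : Pred (Subset n) p} (P? : Decidable P) → count P? F ≡ count P? realised
      same P? = Unique⇒count≡ P? unique
        (Unique.filter⁺ _∈F? (Unique.filter⁺ admissible? (subsets-unique n))) F⊆realised realised⊆F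

allRefuted : ∀ n → 2 ≤ n → n ≤ 5 → all Search.refutedAll (subsets n) ≡ true
allRefuted 2 _ _ = refl
allRefuted 3 _ _ = refl
allRefuted 4 _ _ = refl
allRefuted 5 _ _ = refl
allRefuted 1 (s≤s ()) _
allRefuted (suc (suc (suc (suc (suc (suc _)))))) _ (s≤s (s≤s (s≤s (s≤s (s≤s ())))))

refutedAll-true : ∀ {n} → 2 ≤ n → n ≤ 5 → (A : Subset n) → Search.refutedAll A ≡ true
refutedAll-true {n} 2≤n n≤5 A = Equivalence.to T-≡ (All.lookup
  (All.all⁺ Search.refutedAll (subsets n) (Equivalence.from T-≡ (allRefuted n 2≤n n≤5)))
  (∈-subsets A))

abundantSet : ∀ {n} → Family n → Subset n
abundantSet F = Vec.tabulate (does ∘ abundant? F)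

module _ {n} {F : Family n} (unique : Unique F) (closed : UnionClosed F)
         (∅∈F : ContainsEmpty F) {k} (2≤k : 2 ≤ k) where

  fewAbundant⇒counterexample : TEquals F k → ∣ abundantSet F ∣ < k →
                               Search.Counterexample (abundantSet F) F
  fewAbundant⇒counterexample ((s₀ , s₀∈F , ∣s₀∣≡k , 1≤k) , minimal) few = record
    { unique     = unique
    ; closed     = closed
    ; ∅∈F        = ∅∈F
    ; admissible = All.tabulate admissible
    ; rare       = rare
    ; nonempty   = lose s₀∈F (∣p∣>0⇒nonempty (subst (0 <_) (sym ∣s₀∣≡k) 1≤k))
    }
    where
    rare : Search.RareOutside (abundantSet F) F
    rare j j∉A = ¬abundant⇒rare {F = F} (j∉A ∘ ∈-tabulate-does (abundant? F))

    admissible : ∀ {s} → s ∈ₗ F → Search.Admissible (abundantSet F) s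
    admissible s∈F s≢∅ = ≤-trans (⊔-lub 2≤k few) (minimal s∈F s≢∅) ,
      λ (i , j , i∉A , j∉A , s≡) →
        ¬rarePair unique closed (subst (_∈ₗ F) s≡ s∈F) (rare i i∉A , rare j j∉A)

mainTheorem6 : (n : ℕ) → 2 ≤ n → n ≤ 5 → (F : Family n) →
    IsFamily F → UnionClosed F → ContainsEmpty F → CoversGround F →
    (k : ℕ) → TEquals F k → 2 ≤ k →
    ∃[ is ] (Unique is × k ≤ length is × All (Abundant F) is)
mainTheorem6 n 2≤n n≤5 F unique closed ∅∈F _ k T≡k 2≤k =
  abundants , Unique.filter⁺ (abundant? F) (Unique.allFin⁺ n) , ≮⇒≥ fewAbundant⇒⊥ ,
  All.all-filter (abundant? F) (allFin n)
  where
  abundants : List (Fin n)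
  abundants = filter (abundant? F) (allFin n)

  fewAbundant⇒⊥ : ¬ length abundants < k
  fewAbundant⇒⊥ few = not-¬ (refutedAll-true 2≤n n≤5 (abundantSet F))
    (Search.refutedAll-sound (abundantSet F) (fewAbundant⇒counterexample unique closed ∅∈F 2≤k T≡k
      (subst (_< k) (sym (∣tabulate∣≡count (abundant? F) id)) few)))
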